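{- The map $\varpi$ defined on $\Lambda'_{\mathrm{af}}$ by $\varpi(f)(t_\mu u)=f(t_\mu)$ for $\mu\in Q^\vee$ and $u\in W$ takes values in $\Lambda'_{\mathrm{Gr}}$, is an $S$-algebra homomorphism $\Lambda'_{\mathrm{af}}\to\Lambda'_{\mathrm{Gr}}$, and restricts to the identity on $\Lambda'_{\mathrm{Gr}}\subseteq\Lambda'_{\mathrm{af}}$.
   Context: Fix an irreducible finite root datum with weight lattice $X$, roots $\Phi$, coroots $\alpha^\vee$, reflections $s_\alpha$, coroot lattice $Q^\vee$, Weyl group $W$. Let $S=\mathrm{Sym}(X)$. The affine Weyl group is $W_{\mathrm{af}}=W\ltimes Q^\vee$ (every element uniquely $t_\mu u$ with $\mu\in Q^\vee$, $u\in W$), with $wt_\mu w^{ -1}=t_{w\mu}$. Functions $W_{\mathrm{af}}\to S$ are extended $\mathbb{Z}$-linearly to $\mathbb{Z}[W_{\mathrm{af}}]$ and form an $S$-algebra under pointwise operations. $\Lambda'_{\mathrm{af}}$ is the set of $f:W_{\mathrm{af}}\to S$ such that for all $\alpha\in\Phi$, $k\in\mathbb{Z}$, $d\in\mathbb{Z}_{>0}$, $w\in W_{\mathrm{af}}$: (i) $f(s_\alpha t_{k\alpha^\vee}w)-f(w)\in\alpha S$; (ii) $f((1-t_{\alpha^\vee})^dw)\in\alpha^dS$; (iii) $f((1-t_{\alpha^\vee})^{d-1}(1-s_\alpha)w)\in\alpha^dS$. $\Lambda'_{\mathrm{Gr}}$ is the set of $f\in\Lambda'_{\mathrm{af}}$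 that are constant on left cosets $wW$ of $W$ in $W_{\mathrm{af}}$. -}

module Defs where

open import Data.Nat as ℕ using (ℕ; zero; suc)
open import Data.Integer as ℤ using (ℤ; +_)
open import Data.Fin as Fin using (Fin)
open import Data.Bool using (Bool; true; false; if_then_else_)
open import Data.Vec as Vec using (Vec; []; _∷_; zipWith; tabulate; lookup; replicate; updateAt)
open import Data.Vec.Properties using (≡-dec)
open import Data.List as List using (List; []; _∷_; _++_)
open import Data.Product using (Σ; _×_; _,_; ∃-syntax)
open import Data.Sum using (_⊎_)
open import Relation.Nullary using (¬_; yes; no)
open import Relation.Nullary.Decidable using (⌊_⌋)
open import Relation.Binary.PropositionalEquality using (_≡_)

-- The lattice X is ℤ^n (with standard basis), X^∨ = ℤ^n, and the
-- perfect pairing ⟨_,_⟩ is the dot product.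

Lat : ℕ → Set
Lat n = Vec ℤ n

⟨_,_⟩ : ∀ {n} → Lat n → Lat n → ℤ
⟨ x , y ⟩ = Vec.foldr _ ℤ._+_ (+ 0) (zipWith ℤ._*_ x y)

_+L_ : ∀ {n} → Lat n → Lat n → Lat n
_+L_ = zipWith ℤ._+_

_-L_ : ∀ {n} → Lat n → Lat n → Lat n
_-L_ = zipWith ℤ._-_

scaleL : ∀ {n} → ℤ → Lat n → Lat n
scaleL k = Vec.map (k ℤ.*_)

zeroL : ∀ {n} → Lat n
zeroL = replicate _ (+ 0)

refl' : ∀ {n} → Lat n → Lat n → Lat n → Lat n
refl' a a∨ x = x -L scaleL ⟨ x , a∨ ⟩ a

-- Finite root datum (X, Φ, X^∨, Φ^∨), Φ indexed by Fin m with α_i ↦ α_i^∨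

record RootDatum (n : ℕ) : Set where
  field
    m            : ℕ
    root         : Fin m → Lat n
    coroot       : Fin m → Lat n
    root-inj     : ∀ i j → root i ≡ root j → i ≡ j
    coroot-inj   : ∀ i j → coroot i ≡ coroot j → i ≡ j
    pair-two     : ∀ i → ⟨ root i , coroot i ⟩ ≡ + 2
    root-closed  : ∀ i j → ∃[ k ] root k ≡ refl' (root i) (coroot i) (root j)
    coroot-closed : ∀ i j → ∃[ k ] coroot k ≡ refl' (coroot i) (root i) (coroot j)

-- irreducible: Φ nonempty and not a union of two nonempty mutually
-- orthogonal subsets
Irreducible : ∀ {n} → RootDatum n → Set
Irreducible R =
  Fin m ×
  (∀ (P : Fin m → Bool) →
     (∀ i j → P i ≡ true → P j ≡ false →
        (⟨ root i , coroot j ⟩ ≡ + 0) × (⟨ root j , coroot i ⟩ ≡ + 0)) →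
     (∀ i → P i ≡ true) ⊎ (∀ i → P i ≡ false))
  where open RootDatum R

-- S = Sym(X) = ℤ[x_1,…,x_n]; a polynomial is a finite list of terms
-- (coefficient, exponent vector); equality is equality of coefficients.

Poly : ℕ → Set
Poly n = List (ℤ × Vec ℕ n)

coeff : ∀ {n} → Poly n → Vec ℕ n → ℤ
coeff [] e = + 0
coeff ((z , e') ∷ p) e with ≡-dec ℕ._≟_ e' e
... | yes _ = z ℤ.+ coeff p e
... | no _  = coeff p e

_≈P_ : ∀ {n} → Poly n → Poly n → Set
p ≈P q = ∀ e → coeff p e ≡ coeff q e

_+P_ : ∀ {n} → Poly n → Poly n → Poly n
_+P_ = _++_

negP : ∀ {n} → Poly n → Poly n
negP = List.map (λ { (z , e) → (ℤ.- z , e) })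

_-P_ : ∀ {n} → Poly n → Poly n → Poly n
p -P q = p +P negP q

_*P_ : ∀ {n} → Poly n → Poly n → Poly n
p *P q = List.concatMap (λ { (a , e) → List.map (λ { (b , e') → (a ℤ.* b , zipWith ℕ._+_ e e') }) q }) p

constP : ∀ {n} → ℤ → Poly n
constP z = (z , replicate _ 0) ∷ []

oneP : ∀ {n} → Poly n
oneP = constP (+ 1)

_^P_ : ∀ {n} → Poly n → ℕ → Poly n
p ^P zero = oneP
p ^P suc d = p *P (p ^P d)

linP : ∀ {n} → Lat n → Poly n
linP {n} x = Vec.toList (tabulate (λ i → (lookup x i , tabulate (λ j → if ⌊ i Fin.≟ j ⌋ then 1 else 0))))

InIdeal : ∀ {n} → Poly n → Poly n → Set
InIdeal a x = Σ (Poly _) (λ q → x ≈P (a *P q))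

-- Affine Weyl group W_af = W ⋉ Q^∨, elements t_μ u represented by
-- (coefficients of μ in the coroots, a word in the reflections for u),
-- up to the equivalence "same μ ∈ X^∨ and same u ∈ GL(X)".

module _ {n : ℕ} (R : RootDatum n) where
  open RootDatum R

  WAf : Set
  WAf = Vec ℤ m × List (Fin m)

  coVec : Vec ℤ m → Lat n
  coVec c = Vec.foldr _ _+L_ zeroL (tabulate (λ i → scaleL (lookup c i) (coroot i)))

  actX : List (Fin m) → Lat n → Lat n
  actX [] x = x
  actX (i ∷ u) x = refl' (root i) (coroot i) (actX u x)

  _≈W_ : WAf → WAf → Set
  (c , u) ≈W (c' , u') = (coVec c ≡ coVec c') × (∀ x → actX u x ≡ actX u' x)

  tmul : Fin m → ℤ → WAf → WAf
  tmul i k (c , u) = (updateAt c i (λ z → k ℤ.+ z) , u)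

  -- left multiplication by s_{α_i}:  s t_μ u = t_{μ - ⟨α,μ⟩α^∨} s u
  smul : Fin m → WAf → WAf
  smul i (c , u) = (updateAt c i (λ z → z ℤ.- ⟨ root i , coVec c ⟩) , i ∷ u)

  rmulW : WAf → List (Fin m) → WAf
  rmulW (c , u) v = (c , u ++ v)

  transl : WAf → WAf
  transl (c , u) = (c , [])

  Fn : Set
  Fn = WAf → Poly n

  Resp : Fn → Set
  Resp f = ∀ w w' → w ≈W w' → f w ≈P f w'

  -- group ring ℤ[W_af] as formal finite sums
  GR : Set
  GR = List (ℤ × WAf)

  ev : Fn → GR → Poly n
  ev f [] = []
  ev f ((z , w) ∷ L) = (constP z *P f w) +P ev f L

  oneMinusT : Fin m → GR → GR
  oneMinusT i L = L ++ List.map (λ { (z , w) → (ℤ.- z , tmul i (+ 1) w) }) L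

  oneMinusS : Fin m → GR → GR
  oneMinusS i L = L ++ List.map (λ { (z , w) → (ℤ.- z , smul i w) }) L

  iter : ℕ → (GR → GR) → GR → GR
  iter zero g L = L
  iter (suc d) g L = g (iter d g L)

  elt : WAf → GR
  elt w = (+ 1 , w) ∷ []

  -- Λ'_af (well-defined functions W_af → S satisfying (i)–(iii));
  -- d > 0 is written as suc d.
  LambdaAf : Fn → Set
  LambdaAf f =
    Resp f ×
    (∀ i k w → InIdeal (linP (root i)) (f (smul i (tmul i k w)) -P f w)) ×
    (∀ i d w → InIdeal (linP (root i) ^P suc d)
                       (ev f (iter (suc d) (oneMinusT i) (elt w)))) ×
    (∀ i d w → InIdeal (linP (root i) ^P suc d)
                       (ev f (iter d (oneMinusT i) (oneMinusS i (elt w)))))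

  LambdaGr : Fn → Set
  LambdaGr f = LambdaAf f × (∀ w v → f (rmulW w v) ≈P f w)

  varpi : Fn → Fn
  varpi f w = f (transl w)

  _+F_ : Fn → Fn → Fn
  (f +F g) w = f w +P g w

  _*F_ : Fn → Fn → Fn
  (f *F g) w = f w *P g w

  _·F_ : Poly n → Fn → Fn
  (s ·F f) w = s *P f w

  oneF : Fn
  oneF w = oneP

  _≈F_ : Fn → Fn → Set
  f ≈F g = ∀ w → f w ≈P g w

-- ϖ f only reads f on the translation subgroup Q^∨, so it is constant on
-- left cosets of W, commutes with all pointwise operations, and fixes
-- functions that were already constant on these cosets.  The content is
-- that ϖ f satisfies (i)–(iii).  Applying (i) twice, through s_α and then
-- through s_α with k = 0, shows f(t_{μ+jα^∨}) ≡ f(t_μ) mod α; this gives (i)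
-- for ϖ f because s_α t_{kα^∨} t_μ u has translation part μ + (k − ⟨α,μ+kα^∨⟩)α^∨.
-- Condition (ii) for ϖ f is (ii) for f at t_μ, since translations commute.
-- For (iii), the left side for ϖ f at t_μ u is Δ^d f(t_μ) − Δ^d f(t_{μ−⟨α,μ⟩α^∨})
-- with Δ the difference along t_{α^∨}, and (ii) says exactly that Δ^d f
-- changes by a multiple of α^{d+1} under t_{α^∨}; telescoping along the
-- α^∨-line through μ finishes the proof.
module Submission where

open import Defs
open import Data.Nat as ℕ using (ℕ; zero; suc)
import Data.Nat.Properties as ℕ
open import Data.Integer as ℤ using (ℤ; +_; -[1+_]; _+_; _*_; -_; _-_)
open import Data.Integer.Properties
  using (+-identityˡ; +-assoc; +-comm; +-inverseʳ; *-zeroʳ; *-distribˡ-+; neg-distrib-+; neg-distribʳ-*)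
open import Data.Integer.Tactic.RingSolver using (solve-∀)
open import Data.Fin using (Fin)
open import Data.Vec as Vec using (Vec; []; _∷_; tabulate; lookup; updateAt)
open import Data.Vec.Properties
  using (≡-dec; zipWith-identityˡ; updateAt-id-local; updateAt-updateAt-local; updateAt-cong-local)
open import Data.List as List using (List; []; _∷_; _++_)
open import Data.List.Properties using (++-assoc)
open import Data.Product using (_×_; _,_; proj₁)
open import Relation.Nullary using (yes; no)
open import Relation.Binary.Bundles using (Setoid)
open import Relation.Binary.PropositionalEquality
import Relation.Binary.Reasoning.Setoid as SetoidReasoning

private
  variable
    k : ℕ

⟨⟩-distribʳ-+L : (a u v : Lat k) → ⟨ a , u +L v ⟩ ≡ ⟨ a , u ⟩ + ⟨ a , v ⟩
⟨⟩-distribʳ-+L [] [] [] = refl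
⟨⟩-distribʳ-+L (a ∷ as) (u ∷ us) (v ∷ vs) =
  trans (cong (_+_ (a * (u + v))) (⟨⟩-distribʳ-+L as us vs)) (lem a u v _ _)
  where
  lem : ∀ a u v p q → a * (u + v) + (p + q) ≡ (a * u + p) + (a * v + q)
  lem = solve-∀

⟨⟩-scaleLʳ : (a b : Lat k) (x : ℤ) → ⟨ a , scaleL x b ⟩ ≡ x * ⟨ a , b ⟩
⟨⟩-scaleLʳ [] [] x = sym (*-zeroʳ x)
⟨⟩-scaleLʳ (a ∷ as) (b ∷ bs) x =
  trans (cong (_+_ (a * (x * b))) (⟨⟩-scaleLʳ as bs x)) (lem a b x _)
  where
  lem : ∀ a b x p → a * (x * b) + x * p ≡ x * (a * b + p)
  lem = solve-∀

⟨⟩-linearˡ : (y a b : Lat k) (p : ℤ) → ⟨ y -L scaleL p a , b ⟩ ≡ ⟨ y , b ⟩ - p * ⟨ a , b ⟩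
⟨⟩-linearˡ [] [] [] p = lem p
  where
  lem : ∀ p → + 0 ≡ + 0 - p * + 0
  lem = solve-∀
⟨⟩-linearˡ (y ∷ ys) (a ∷ as) (b ∷ bs) p =
  trans (cong (_+_ ((y - p * a) * b)) (⟨⟩-linearˡ ys as bs p)) (lem y a b p _ _)
  where
  lem : ∀ y a b p q r → (y - p * a) * b + (q - p * r) ≡ (y * b + q) - p * (a * b + r)
  lem = solve-∀

refl'-involutive : (a a∨ x : Lat k) → ⟨ a , a∨ ⟩ ≡ + 2 → refl' a a∨ (refl' a a∨ x) ≡ x
refl'-involutive a a∨ x a·a∨≡2 = begin
  y -L scaleL ⟨ y , a∨ ⟩ a     ≡⟨ cong (λ q → y -L scaleL q a) ⟨y,a∨⟩≡ ⟩
  y -L scaleL (p - p * + 2) a  ≡⟨ cancel x a p ⟩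
  x                            ∎
  where
  open ≡-Reasoning
  p = ⟨ x , a∨ ⟩
  y = x -L scaleL p a
  ⟨y,a∨⟩≡ : ⟨ y , a∨ ⟩ ≡ p - p * + 2
  ⟨y,a∨⟩≡ = trans (⟨⟩-linearˡ x a a∨ p) (cong (λ t → p - p * t) a·a∨≡2)
  cancel : ∀ {j} (x a : Lat j) p → (x -L scaleL p a) -L scaleL (p - p * + 2) a ≡ x
  cancel [] [] p = refl
  cancel (x ∷ xs) (a ∷ as) p = cong₂ _∷_ (lem x a p) (cancel xs as p)
    where
    lem : ∀ x a p → (x - p * a) - (p - p * + 2) * a ≡ x
    lem = solve-∀

lincomb : ∀ {j} → Vec ℤ j → (Fin j → Lat k) → Lat k
lincomb c β = Vec.foldr _ _+L_ zeroL (tabulate (λ i → scaleL (lookup c i) (β i)))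

lincomb-updateAt : ∀ {j} (c : Vec ℤ j) (β : Fin j → Lat k) i x →
  lincomb (updateAt c i (_+_ x)) β ≡ scaleL x (β i) +L lincomb c β
lincomb-updateAt (z ∷ c) β Fin.zero x = distrib x z (β Fin.zero) _
  where
  distrib : ∀ {j} x z (b r : Lat j) → scaleL (x + z) b +L r ≡ scaleL x b +L (scaleL z b +L r)
  distrib x z [] [] = refl
  distrib x z (b ∷ bs) (r ∷ rs) = cong₂ _∷_ (lem x z b r) (distrib x z bs rs)
    where
    lem : ∀ x z b r → (x + z) * b + r ≡ x * b + (z * b + r)
    lem = solve-∀
lincomb-updateAt (z ∷ c) β (Fin.suc i) x =
  trans (cong (scaleL z (β Fin.zero) +L_) (lincomb-updateAt c (λ j → β (Fin.suc j)) i x))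
        (swap (scaleL z (β Fin.zero)) (scaleL x (β (Fin.suc i))) _)
  where
  swap : ∀ {j} (a b r : Lat j) → a +L (b +L r) ≡ b +L (a +L r)
  swap [] [] [] = refl
  swap (a ∷ as) (b ∷ bs) (r ∷ rs) = cong₂ _∷_ (lem a b r) (swap as bs rs)
    where
    lem : ∀ a b r → a + (b + r) ≡ b + (a + r)
    lem = solve-∀

module _ {n : ℕ} where

  ≈P-setoid : Setoid _ _
  ≈P-setoid = record
    { Carrier = Poly n
    ; _≈_ = _≈P_
    ; isEquivalence = record
      { refl = λ _ → refl
      ; sym = λ p≈q e → sym (p≈q e)
      ; trans = λ p≈q q≈r e → trans (p≈q e) (q≈r e)
      }
    }

  coeff-+P : (p q : Poly n) (e : Vec ℕ n) → coeff (p +P q) e ≡ coeff p e + coeff q e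
  coeff-+P [] q e = sym (+-identityˡ _)
  coeff-+P ((z , e′) ∷ p) q e with ≡-dec ℕ._≟_ e′ e
  ... | yes _ = trans (cong (_+_ z) (coeff-+P p q e)) (sym (+-assoc z _ _))
  ... | no  _ = coeff-+P p q e

  coeff-negP : (p : Poly n) (e : Vec ℕ n) → coeff (negP p) e ≡ - coeff p e
  coeff-negP [] e = refl
  coeff-negP ((z , e′) ∷ p) e with ≡-dec ℕ._≟_ e′ e
  ... | yes _ = trans (cong (_+_ (- z)) (coeff-negP p e)) (sym (neg-distrib-+ z _))
  ... | no  _ = coeff-negP p e

  coeff--P : (p q : Poly n) (e : Vec ℕ n) → coeff (p -P q) e ≡ coeff p e - coeff q e
  coeff--P p q e = trans (coeff-+P p (negP q) e) (cong (_+_ (coeff p e)) (coeff-negP q e))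

  coeff-constP-*P : (z : ℤ) (p : Poly n) (e : Vec ℕ n) → coeff (constP z *P p) e ≡ z * coeff p e
  coeff-constP-*P z [] e = sym (*-zeroʳ z)
  coeff-constP-*P z ((b , e′) ∷ p) e =
    scale-∷ (zipWith-identityˡ ℕ.+-identityˡ e′) _ (coeff-constP-*P z p e)
    where
    scale-∷ : ∀ {e₁ e₂} → e₁ ≡ e₂ → (p′ : Poly n) → coeff p′ e ≡ z * coeff p e →
      coeff ((z * b , e₁) ∷ p′) e ≡ z * coeff ((b , e₂) ∷ p) e
    scale-∷ {e₁} refl p′ h with ≡-dec ℕ._≟_ e₁ e
    ... | yes _ = trans (cong (_+_ (z * b)) h) (sym (*-distribˡ-+ z b _))
    ... | no  _ = h

  *P-∷ : (t : ℤ × Vec ℕ n) (a q : Poly n) → ((t ∷ a) *P q) ≡ ((t ∷ []) *P q) +P (a *P q)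
  *P-∷ t a q = sym (++-assoc _ [] (a *P q))

  term-*P-+P : (t : ℤ × Vec ℕ n) (q r : Poly n) →
    ((t ∷ []) *P (q +P r)) ≡ ((t ∷ []) *P q) +P ((t ∷ []) *P r)
  term-*P-+P t [] r = refl
  term-*P-+P t (s ∷ q) r = cong (_ ∷_) (term-*P-+P t q r)

  term-*P-negP : (t : ℤ × Vec ℕ n) (q : Poly n) → ((t ∷ []) *P negP q) ≡ negP ((t ∷ []) *P q)
  term-*P-negP t [] = refl
  term-*P-negP (z , eₜ) ((b , e′) ∷ q) =
    cong₂ _∷_ (cong (_, _) (sym (neg-distribʳ-* z b))) (term-*P-negP (z , eₜ) q)

  coeff-*P-[] : (a : Poly n) (e : Vec ℕ n) → coeff (a *P []) e ≡ + 0
  coeff-*P-[] [] e = refl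
  coeff-*P-[] (_ ∷ a) e = coeff-*P-[] a e

  coeff-*P-+P : (a q r : Poly n) (e : Vec ℕ n) → coeff (a *P (q +P r)) e ≡ coeff (a *P q) e + coeff (a *P r) e
  coeff-*P-+P [] q r e = refl
  coeff-*P-+P (t ∷ a) q r e = begin
    coeff ((t ∷ a) *P (q +P r)) e
      ≡⟨ cong (λ l → coeff l e) (trans (*P-∷ t a (q +P r)) (cong (_+P (a *P (q +P r))) (term-*P-+P t q r))) ⟩
    coeff ((tq +P tr) +P (a *P (q +P r))) e
      ≡⟨ trans (coeff-+P (tq +P tr) _ e) (cong₂ _+_ (coeff-+P tq tr e) (coeff-*P-+P a q r e)) ⟩
    (coeff tq e + coeff tr e) + (coeff (a *P q) e + coeff (a *P r) e)
      ≡⟨ lem (coeff tq e) (coeff tr e) (coeff (a *P q) e) (coeff (a *P r) e) ⟩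
    (coeff tq e + coeff (a *P q) e) + (coeff tr e + coeff (a *P r) e)
      ≡⟨ sym (cong₂ _+_ (coeff-+P tq (a *P q) e) (coeff-+P tr (a *P r) e)) ⟩
    coeff (tq +P (a *P q)) e + coeff (tr +P (a *P r)) e
      ≡⟨ sym (cong₂ (λ l l′ → coeff l e + coeff l′ e) (*P-∷ t a q) (*P-∷ t a r)) ⟩
    coeff ((t ∷ a) *P q) e + coeff ((t ∷ a) *P r) e
      ∎
    where
    open ≡-Reasoning
    tq = (t ∷ []) *P q
    tr = (t ∷ []) *P r
    lem : ∀ a b c d → (a + b) + (c + d) ≡ (a + c) + (b + d)
    lem = solve-∀

  coeff-*P-negP : (a q : Poly n) (e : Vec ℕ n) → coeff (a *P negP q) e ≡ - coeff (a *P q) e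
  coeff-*P-negP [] q e = refl
  coeff-*P-negP (t ∷ a) q e = begin
    coeff ((t ∷ a) *P negP q) e
      ≡⟨ cong (λ l → coeff l e) (trans (*P-∷ t a (negP q)) (cong (_+P (a *P negP q)) (term-*P-negP t q))) ⟩
    coeff (negP tq +P (a *P negP q)) e
      ≡⟨ trans (coeff-+P (negP tq) _ e) (cong₂ _+_ (coeff-negP tq e) (coeff-*P-negP a q e)) ⟩
    - coeff tq e + - coeff (a *P q) e
      ≡⟨ sym (neg-distrib-+ (coeff tq e) (coeff (a *P q) e)) ⟩
    - (coeff tq e + coeff (a *P q) e)
      ≡⟨ cong -_ (sym (trans (cong (λ l → coeff l e) (*P-∷ t a q)) (coeff-+P tq (a *P q) e))) ⟩
    - coeff ((t ∷ a) *P q) e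
      ∎
    where
    open ≡-Reasoning
    tq = (t ∷ []) *P q

  InIdeal-resp : {a p q : Poly n} → p ≈P q → InIdeal a p → InIdeal a q
  InIdeal-resp p≈q (r , p≈ar) = r , λ e → trans (sym (p≈q e)) (p≈ar e)

  infix 4 _≋_[mod_]
  _≋_[mod_] : Poly n → Poly n → Poly n → Set
  p ≋ q [mod a ] = InIdeal a (p -P q)

  ≋-refl : {a p : Poly n} → p ≋ p [mod a ]
  ≋-refl {a} {p} = [] , λ e →
    trans (coeff--P p p e) (trans (+-inverseʳ (coeff p e)) (sym (coeff-*P-[] a e)))

  ≋-sym : {a p q : Poly n} → p ≋ q [mod a ] → q ≋ p [mod a ]
  ≋-sym {a} {p} {q} (r , p-q≈ar) = negP r , λ e → begin
    coeff (q -P p) e          ≡⟨ coeff--P q p e ⟩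
    coeff q e - coeff p e     ≡⟨ lem (coeff p e) (coeff q e) ⟩
    - (coeff p e - coeff q e) ≡⟨ cong -_ (trans (sym (coeff--P p q e)) (p-q≈ar e)) ⟩
    - coeff (a *P r) e        ≡⟨ sym (coeff-*P-negP a r e) ⟩
    coeff (a *P negP r) e     ∎
    where
    open ≡-Reasoning
    lem : ∀ x y → y - x ≡ - (x - y)
    lem = solve-∀

  ≋-trans : {a p q r : Poly n} → p ≋ q [mod a ] → q ≋ r [mod a ] → p ≋ r [mod a ]
  ≋-trans {a} {p} {q} {r} (s , p-q≈as) (t , q-r≈at) = s ++ t , λ e → begin
    coeff (p -P r) e                                  ≡⟨ coeff--P p r e ⟩
    coeff p e - coeff r e                             ≡⟨ lem (coeff p e) (coeff q e) (coeff r e) ⟩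
    (coeff p e - coeff q e) + (coeff q e - coeff r e) ≡⟨ cong₂ _+_ (trans (sym (coeff--P p q e)) (p-q≈as e))
                                                                   (trans (sym (coeff--P q r e)) (q-r≈at e)) ⟩
    coeff (a *P s) e + coeff (a *P t) e               ≡⟨ sym (coeff-*P-+P a s t e) ⟩
    coeff (a *P (s ++ t)) e                           ∎
    where
    open ≡-Reasoning
    lem : ∀ x y z → x - z ≡ (x - y) + (y - z)
    lem = solve-∀

  ≋-respˡ : {a p p′ q : Poly n} → p ≈P p′ → p ≋ q [mod a ] → p′ ≋ q [mod a ]
  ≋-respˡ {a} {p} {p′} {q} p≈p′ = InIdeal-resp {a} {p -P q} {p′ -P q}
    λ e → trans (coeff--P p q e) (trans (cong (_- coeff q e) (p≈p′ e)) (sym (coeff--P p′ q e)))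

module _ {n : ℕ} (R : RootDatum n) where
  open RootDatum R

  private
    W = WAf R
    α : Fin m → Poly n
    α i = linP (root i)

  Cond-i Cond-ii Cond-iii : Fn R → Set
  Cond-i f = ∀ i k w → f (smul R i (tmul R i k w)) ≋ f w [mod α i ]
  Cond-ii f = ∀ i d w → InIdeal (α i ^P suc d) (ev R f (iter R (suc d) (oneMinusT R i) (elt R w)))
  Cond-iii f = ∀ i d w → InIdeal (α i ^P suc d) (ev R f (iter R d (oneMinusT R i) (oneMinusS R i (elt R w))))

  upd : Fin m → ℤ → Vec ℤ m → Vec ℤ m
  upd i x c = updateAt c i (_+_ x)

  pair : Fin m → Vec ℤ m → ℤ
  pair i c = ⟨ root i , coVec R c ⟩

  upd-upd : ∀ i x y c → upd i x (upd i y c) ≡ upd i (x + y) c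
  upd-upd i x y c = updateAt-updateAt-local i c (sym (+-assoc x y _))

  upd-zero : ∀ i c → upd i (+ 0) c ≡ c
  upd-zero i c = updateAt-id-local i c (+-identityˡ _)

  pair-upd : ∀ i x c → pair i (upd i x c) ≡ + 2 * x + pair i c
  pair-upd i x c = begin
    ⟨ root i , coVec R (upd i x c) ⟩               ≡⟨ cong (⟨ root i ,_⟩) (lincomb-updateAt c coroot i x) ⟩
    ⟨ root i , scaleL x (coroot i) +L coVec R c ⟩ ≡⟨ ⟨⟩-distribʳ-+L (root i) _ _ ⟩
    ⟨ root i , scaleL x (coroot i) ⟩ + pair i c   ≡⟨ cong (_+ pair i c) (⟨⟩-scaleLʳ (root i) (coroot i) x) ⟩
    x * ⟨ root i , coroot i ⟩ + pair i c          ≡⟨ cong (λ t → x * t + pair i c) (pair-two i) ⟩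
    x * + 2 + pair i c                            ≡⟨ lem x (pair i c) ⟩
    + 2 * x + pair i c                            ∎
    where
    open ≡-Reasoning
    lem : ∀ x p → x * + 2 + p ≡ + 2 * x + p
    lem = solve-∀

  smul-coeffs : ∀ i c → updateAt c i (λ z → z - pair i c) ≡ upd i (- pair i c) c
  smul-coeffs i c = updateAt-cong-local i c (+-comm (lookup c i) (- pair i c))

  tmul-tmul : ∀ i x y (w : W) → tmul R i x (tmul R i y w) ≡ tmul R i (x + y) w
  tmul-tmul i x y (c , u) = cong (_, u) (upd-upd i x y c)

  tmul-zero : ∀ i (w : W) → tmul R i (+ 0) w ≡ w
  tmul-zero i (c , u) = cong (_, u) (upd-zero i c)

  transl-smul : ∀ i (w : W) → transl R (smul R i w) ≡ tmul R i (- pair i (proj₁ w)) (transl R w)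
  transl-smul i (c , u) = cong (_, []) (smul-coeffs i c)

  smul-involutive : ∀ i (w : W) → _≈W_ R (smul R i (smul R i w)) w
  smul-involutive i (c , u) =
    cong (coVec R) coeffs , λ x → refl'-involutive (root i) (coroot i) (actX R u x) (pair-two i)
    where
    open ≡-Reasoning
    p = pair i c
    c₁ = updateAt c i (λ z → z - p)
    lem₁ : ∀ p → + 2 * - p + p ≡ - p
    lem₁ = solve-∀
    lem₂ : ∀ p → - - p + - p ≡ + 0
    lem₂ = solve-∀
    pair-c₁ : pair i c₁ ≡ - p
    pair-c₁ = trans (cong (pair i) (smul-coeffs i c)) (trans (pair-upd i (- p) c) (lem₁ p))
    coeffs : updateAt c₁ i (λ z → z - pair i c₁) ≡ c
    coeffs = begin
      updateAt c₁ i (λ z → z - pair i c₁) ≡⟨ smul-coeffs i c₁ ⟩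
      upd i (- pair i c₁) c₁              ≡⟨ cong₂ (upd i) (cong -_ pair-c₁) (smul-coeffs i c) ⟩
      upd i (- - p) (upd i (- p) c)       ≡⟨ upd-upd i (- - p) (- p) c ⟩
      upd i (- - p + - p) c               ≡⟨ cong (λ x → upd i x c) (lem₂ p) ⟩
      upd i (+ 0) c                       ≡⟨ upd-zero i c ⟩
      c                                   ∎

  tmul-≋ : ∀ {f} → Resp R f → Cond-i f → ∀ i k w → f (tmul R i k w) ≋ f w [mod α i ]
  tmul-≋ {f} resp cond-i i k w =
    ≋-trans {a = α i} {p = f (tmul R i k w)} {q = f v} {r = f w}
      (≋-respˡ {a = α i} {p = f (smul R i (tmul R i (+ 0) v))} {p′ = f (tmul R i k w)} {q = f v}
               back (cond-i i (+ 0) v))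
      (cond-i i k w)
    where
    v = smul R i (tmul R i k w)
    back : f (smul R i (tmul R i (+ 0) v)) ≈P f (tmul R i k w)
    back = resp _ _ (subst (λ v′ → _≈W_ R (smul R i v′) (tmul R i k w)) (sym (tmul-zero i v))
                          (smul-involutive i (tmul R i k w)))

  module _ {a : Poly n} (g : Fn R) (i : Fin m) (step : ∀ w → g w ≋ g (tmul R i (+ 1) w) [mod a ]) where

    telescope-ℕ : ∀ k w → g w ≋ g (tmul R i (+ k) w) [mod a ]
    telescope-ℕ zero w =
      subst (λ v → g w ≋ g v [mod a ]) (sym (tmul-zero i w)) (≋-refl {a = a} {p = g w})
    telescope-ℕ (suc k) w =
      ≋-trans {a = a} {p = g w} {q = g (tmul R i (+ k) w)} {r = g (tmul R i (+ suc k) w)}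
        (telescope-ℕ k w)
        (subst (λ v → g (tmul R i (+ k) w) ≋ g v [mod a ]) (tmul-tmul i (+ 1) (+ k) w)
               (step (tmul R i (+ k) w)))

    telescope : ∀ r w → g w ≋ g (tmul R i r w) [mod a ]
    telescope (+ k) w = telescope-ℕ k w
    telescope -[1+ k ] w =
      ≋-sym {a = a} {p = g v} {q = g w} (subst (λ x → g v ≋ g x [mod a ]) v-back (telescope-ℕ (suc k) v))
      where
      v = tmul R i -[1+ k ] w
      v-back : tmul R i (+ suc k) v ≡ w
      v-back = trans (tmul-tmul i (+ suc k) -[1+ k ] w)
                     (trans (cong (λ x → tmul R i x w) (+-inverseʳ (+ suc k))) (tmul-zero i w))

  coeff-ev-∷ : ∀ (f : Fn R) z w L e →
    coeff (ev R f ((z , w) ∷ L)) e ≡ z * coeff (f w) e + coeff (ev R f L) e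
  coeff-ev-∷ f z w L e =
    trans (coeff-+P (constP z *P f w) (ev R f L) e) (cong (_+ coeff (ev R f L) e) (coeff-constP-*P z (f w) e))

  ev-++ : ∀ (f : Fn R) L M → ev R f (L ++ M) ≡ ev R f L +P ev R f M
  ev-++ f [] M = refl
  ev-++ f ((z , w) ∷ L) M =
    trans (cong (_+P_ (constP z *P f w)) (ev-++ f L M)) (sym (++-assoc (constP z *P f w) (ev R f L) _))

  -- G stands for the anonymous pattern lambda that oneMinusT maps over its argument.
  ev-map-neg : ∀ (f : Fn R) (g : W → W) (G : ℤ × W → ℤ × W) → (∀ z w → G (z , w) ≡ (- z , g w)) →
    ∀ L → ev R f (List.map G L) ≈P negP (ev R (λ w → f (g w)) L)
  ev-map-neg f g G G≡ [] e = refl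
  ev-map-neg f g G G≡ ((z , w) ∷ L) e rewrite G≡ z w = begin
    coeff (ev R f ((- z , g w) ∷ List.map G L)) e  ≡⟨ coeff-ev-∷ f (- z) (g w) (List.map G L) e ⟩
    - z * a + coeff (ev R f (List.map G L)) e      ≡⟨ cong (_+_ (- z * a)) (ev-map-neg f g G G≡ L e) ⟩
    - z * a + coeff (negP (ev R fg L)) e           ≡⟨ cong (_+_ (- z * a)) (coeff-negP (ev R fg L) e) ⟩
    - z * a + - coeff (ev R fg L) e                ≡⟨ lem z a _ ⟩
    - (z * a + coeff (ev R fg L) e)                ≡⟨ cong -_ (sym (coeff-ev-∷ fg z w L e)) ⟩
    - coeff (ev R fg ((z , w) ∷ L)) e              ≡⟨ sym (coeff-negP (ev R fg ((z , w) ∷ L)) e) ⟩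
    coeff (negP (ev R fg ((z , w) ∷ L))) e         ∎
    where
    open ≡-Reasoning
    fg = λ w → f (g w)
    a = coeff (f (g w)) e
    lem : ∀ z a b → - z * a + - b ≡ - (z * a + b)
    lem = solve-∀

  ev--F : ∀ (f g : Fn R) L → ev R (λ w → f w -P g w) L ≈P (ev R f L -P ev R g L)
  ev--F f g [] e = refl
  ev--F f g ((z , w) ∷ L) e = begin
    coeff (ev R f-g ((z , w) ∷ L)) e
      ≡⟨ coeff-ev-∷ f-g z w L e ⟩
    z * coeff (f w -P g w) e + coeff (ev R f-g L) e
      ≡⟨ cong₂ (λ x y → z * x + y) (coeff--P (f w) (g w) e) (trans (ev--F f g L e) (coeff--P fL gL e)) ⟩
    z * (coeff (f w) e - coeff (g w) e) + (coeff fL e - coeff gL e)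
      ≡⟨ lem z _ _ _ _ ⟩
    (z * coeff (f w) e + coeff fL e) - (z * coeff (g w) e + coeff gL e)
      ≡⟨ sym (cong₂ _-_ (coeff-ev-∷ f z w L e) (coeff-ev-∷ g z w L e)) ⟩
    coeff (ev R f ((z , w) ∷ L)) e - coeff (ev R g ((z , w) ∷ L)) e
      ≡⟨ sym (coeff--P (ev R f ((z , w) ∷ L)) _ e) ⟩
    coeff (ev R f ((z , w) ∷ L) -P ev R g ((z , w) ∷ L)) e
      ∎
    where
    open ≡-Reasoning
    f-g = λ w → f w -P g w
    fL = ev R f L
    gL = ev R g L
    lem : ∀ z a b c d → z * (a - b) + (c - d) ≡ (z * a + c) - (z * b + d)
    lem = solve-∀

  ev-++-map-neg : ∀ (f : Fn R) (g : W → W) (G : ℤ × W → ℤ × W) → (∀ z w → G (z , w) ≡ (- z , g w)) →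
    ∀ L → ev R f (L ++ List.map G L) ≈P ev R (λ w → f w -P f (g w)) L
  ev-++-map-neg f g G G≡ L e = begin
    coeff (ev R f (L ++ List.map G L)) e  ≡⟨ cong (λ p → coeff p e) (ev-++ f L (List.map G L)) ⟩
    coeff (fL +P ev R f (List.map G L)) e ≡⟨ coeff-+P fL (ev R f (List.map G L)) e ⟩
    coeff fL e + coeff (ev R f (List.map G L)) e
                                          ≡⟨ cong (_+_ (coeff fL e)) (ev-map-neg f g G G≡ L e) ⟩
    coeff fL e + coeff (negP (ev R fg L)) e
                                          ≡⟨ sym (coeff-+P fL (negP (ev R fg L)) e) ⟩
    coeff (fL -P ev R fg L) e             ≡⟨ sym (ev--F f fg L e) ⟩
    coeff (ev R (λ w → f w -P fg w) L) e  ∎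
    where
    open ≡-Reasoning
    fg = λ w → f (g w)
    fL = ev R f L

  Δ : Fin m → Fn R → Fn R
  Δ i f w = f w -P f (tmul R i (+ 1) w)

  Δ^ : ℕ → Fin m → Fn R → Fn R
  Δ^ zero i f = f
  Δ^ (suc d) i f = Δ^ d i (Δ i f)

  Δ^-suc : ∀ d i f (w : W) → Δ^ (suc d) i f w ≡ Δ i (Δ^ d i f) w
  Δ^-suc zero i f w = refl
  Δ^-suc (suc d) i f w = Δ^-suc d i (Δ i f) w

  Δ^-varpi : ∀ d i f (w : W) → Δ^ d i (varpi R f) w ≡ Δ^ d i f (transl R w)
  Δ^-varpi zero i f w = refl
  Δ^-varpi (suc d) i f w = Δ^-varpi d i (Δ i f) w

  ev-oneMinusT : ∀ i f L → ev R f (oneMinusT R i L) ≈P ev R (Δ i f) L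
  ev-oneMinusT i f = ev-++-map-neg f (tmul R i (+ 1)) _ (λ _ _ → refl)

  ev-iter-oneMinusT : ∀ d i f L → ev R f (iter R d (oneMinusT R i) L) ≈P ev R (Δ^ d i f) L
  ev-iter-oneMinusT zero i f L e = refl
  ev-iter-oneMinusT (suc d) i f L e =
    trans (ev-oneMinusT i f (iter R d (oneMinusT R i) L) e) (ev-iter-oneMinusT d i (Δ i f) L e)

  ev-elt : ∀ f (w : W) → ev R f (elt R w) ≈P f w
  ev-elt f w e = trans (coeff-ev-∷ f (+ 1) w [] e) (lem (coeff (f w) e))
    where
    lem : ∀ a → + 1 * a + + 0 ≡ a
    lem = solve-∀

  ev-oneMinusS-elt : ∀ i f (w : W) → ev R f (oneMinusS R i (elt R w)) ≈P (f w -P f (smul R i w))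
  ev-oneMinusS-elt i f w e = begin
    coeff (ev R f ((+ 1 , w) ∷ (- + 1 , sw) ∷ [])) e  ≡⟨ coeff-ev-∷ f (+ 1) w ((- + 1 , sw) ∷ []) e ⟩
    + 1 * a + coeff (ev R f ((- + 1 , sw) ∷ [])) e    ≡⟨ cong (_+_ (+ 1 * a)) (coeff-ev-∷ f (- + 1) sw [] e) ⟩
    + 1 * a + (- + 1 * b + + 0)                       ≡⟨ lem a b ⟩
    a - b                                             ≡⟨ sym (coeff--P (f w) (f sw) e) ⟩
    coeff (f w -P f sw) e                             ∎
    where
    open ≡-Reasoning
    sw = smul R i w
    a = coeff (f w) e
    b = coeff (f sw) e
    lem : ∀ a b → + 1 * a + (- + 1 * b + + 0) ≡ a - b
    lem = solve-∀

  ev-iter-elt : ∀ d i f (w : W) → ev R f (iter R d (oneMinusT R i) (elt R w)) ≈P Δ^ d i f w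
  ev-iter-elt d i f w e = trans (ev-iter-oneMinusT d i f (elt R w) e) (ev-elt (Δ^ d i f) w e)

  Cond-ii⇒Δ^-≋ : ∀ {f} → Cond-ii f →
    ∀ i d w → Δ^ d i f w ≋ Δ^ d i f (tmul R i (+ 1) w) [mod α i ^P suc d ]
  Cond-ii⇒Δ^-≋ {f} cond-ii i d w =
    InIdeal-resp {a = α i ^P suc d} {p = ev R f (iter R (suc d) (oneMinusT R i) (elt R w))}
                 {q = Δ i (Δ^ d i f) w}
                 (λ e → trans (ev-iter-elt (suc d) i f w e) (cong (λ p → coeff p e) (Δ^-suc d i f w)))
                 (cond-ii i d w)

  varpi-Resp : ∀ {f} → Resp R f → Resp R (varpi R f)
  varpi-Resp resp (c , _) (c′ , _) (μ≡μ′ , _) = resp (c , []) (c′ , []) (μ≡μ′ , λ _ → refl)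

  varpi-Cond-i : ∀ {f} → Resp R f → Cond-i f → Cond-i (varpi R f)
  varpi-Cond-i {f} resp cond-i i k w =
    subst (λ v → f v ≋ f (transl R w) [mod α i ]) (sym translation-part)
          (tmul-≋ {f} resp cond-i i (- p + k) (transl R w))
    where
    p = pair i (proj₁ (tmul R i k w))
    translation-part : transl R (smul R i (tmul R i k w)) ≡ tmul R i (- p + k) (transl R w)
    translation-part = trans (transl-smul i (tmul R i k w)) (tmul-tmul i (- p) k (transl R w))

  varpi-Cond-ii : ∀ {f} → Cond-ii f → Cond-ii (varpi R f)
  varpi-Cond-ii {f} cond-ii i d w =
    InIdeal-resp {a = α i ^P suc d} {p = before} {q = after} transfer (cond-ii i d (transl R w))
    where
    before = ev R f (iter R (suc d) (oneMinusT R i) (elt R (transl R w)))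
    after = ev R (varpi R f) (iter R (suc d) (oneMinusT R i) (elt R w))
    transfer : before ≈P after
    transfer e = trans (ev-iter-elt (suc d) i f (transl R w) e)
      (trans (cong (λ p → coeff p e) (sym (Δ^-varpi (suc d) i f w)))
             (sym (ev-iter-elt (suc d) i (varpi R f) w e)))

  varpi-Cond-iii : ∀ {f} → Cond-ii f → Cond-iii (varpi R f)
  varpi-Cond-iii {f} cond-ii i d w =
    InIdeal-resp {a = α i ^P suc d} {p = before} {q = after} (Setoid.sym ≈P-setoid {after} {before} transfer)
      (telescope {a = α i ^P suc d} (Δ^ d i f) i (Cond-ii⇒Δ^-≋ {f} cond-ii i d) (- p) (transl R w))
    where
    open SetoidReasoning ≈P-setoid
    p = pair i (proj₁ w)
    before = Δ^ d i f (transl R w) -P Δ^ d i f (tmul R i (- p) (transl R w))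
    after = ev R (varpi R f) (iter R d (oneMinusT R i) (oneMinusS R i (elt R w)))
    transfer : after ≈P before
    transfer = begin
      after
        ≈⟨ ev-iter-oneMinusT d i (varpi R f) (oneMinusS R i (elt R w)) ⟩
      ev R (Δ^ d i (varpi R f)) (oneMinusS R i (elt R w))
        ≈⟨ ev-oneMinusS-elt i (Δ^ d i (varpi R f)) w ⟩
      Δ^ d i (varpi R f) w -P Δ^ d i (varpi R f) (smul R i w)
        ≡⟨ cong₂ _-P_ (Δ^-varpi d i f w)
                      (trans (Δ^-varpi d i f (smul R i w)) (cong (Δ^ d i f) (transl-smul i w))) ⟩
      before
        ∎

  varpi-LambdaGr : ∀ f → LambdaAf R f → LambdaGr R (varpi R f)
  varpi-LambdaGr f (resp , cond-i , cond-ii , _) =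
    (varpi-Resp {f} resp , varpi-Cond-i {f} resp cond-i , varpi-Cond-ii {f} cond-ii , varpi-Cond-iii {f} cond-ii) ,
    λ _ _ _ → refl

  varpi-fixes-LambdaGr : ∀ f → LambdaGr R f → _≈F_ R (varpi R f) f
  varpi-fixes-LambdaGr f (_ , coset-constant) (c , u) e = sym (coset-constant (c , []) u e)

proposition4p4 : ∀ {n : ℕ} (R : RootDatum n) → Irreducible R →
    (∀ f → LambdaAf R f → LambdaGr R (varpi R f)) ×
    (∀ f g → LambdaAf R f → LambdaAf R g →
       _≈F_ R (varpi R (_+F_ R f g)) (_+F_ R (varpi R f) (varpi R g)) ×
       _≈F_ R (varpi R (_*F_ R f g)) (_*F_ R (varpi R f) (varpi R g))) ×
    (∀ s f → LambdaAf R f → _≈F_ R (varpi R (_·F_ R s f)) (_·F_ R s (varpi R f))) ×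
    _≈F_ R (varpi R (oneF R)) (oneF R) ×
    (∀ f → LambdaGr R f → _≈F_ R (varpi R f) f)
proposition4p4 R _ =
    varpi-LambdaGr R
  , (λ _ _ _ _ → (λ _ _ → refl) , (λ _ _ → refl))
  , (λ _ _ _ _ _ → refl)
  , (λ _ _ → refl)
  , varpi-fixes-LambdaGr R
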